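{- Let $f=f_1\wedge f_2\wedge\cdots\wedge f_m:\{0,1\}^n\to\{0,1\}$, where each $f_i$ is computable by a width-2 read-once branching program and the $f_i$ depend on pairwise disjoint sets of input variables. Then there exists a $\mathsf{CNF}^\oplus$ formula $g:\{0,1\}^n\to\{0,1\}$ such that $g\le f$ pointwise and $\mathbb{E}[g]\ge\mathbb{E}[f]^{O(1)}$.
   Context: A read-once branching program of width $d$ and length $n$ has layers $V_0=\{(0,0)\}$, $V_t=\{(t,i)\}_{i\in[d]}$ ($1\le t\le n-1$), $V_n=\{(n,1),(n,d)\}$ (accept and reject), each vertex of $V_t$ having out-edges labeled $0,1$ into $V_{t+1}$; from layer $t$ the edge labeled $x_{t+1}$ is followed and $x$ is accepted iff the path ends at $(n,1)$. A $\mathsf{CNF}^\oplus$ formula is a conjunction $\bigwedge_i T_i$ where each $T_i$ is a disjunction of literals or a parity of literals, the $T_i$ on pairwise disjoint variables. $\mathbb{E}$ is under the uniform distribution. -}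

module Defs where

open import Data.Bool using (Bool; true; false; if_then_else_; _∧_; _∨_; _xor_; not)
open import Data.Nat using (ℕ; zero; suc; _^_; NonZero)
open import Data.Nat.Properties using (m^n≢0)
open import Data.Fin using (Fin; zero; suc)
open import Data.Vec.Functional using () renaming (_∷_ to _∷ᶠ_)
open import Data.List using (List; []; _∷_; foldr; map)
open import Data.List.Membership.Propositional using (_∈_)
open import Data.List.Relation.Unary.AllPairs using (AllPairs)
open import Data.Product using (Σ; _×_; _,_; proj₁)
open import Data.Empty using (⊥)
open import Data.Integer using (+_)
open import Data.Rational using (ℚ; _/_; 1ℚ; _*_)
open import Relation.Binary.PropositionalEquality using (_≡_; _≢_)

Input : ℕ → Set
Input n = Fin n → Bool

BoolFn : ℕ → Set
BoolFn n = Input n → Bool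

-- Read-once branching programs of width 2 (fixed variable order x_1..x_n).
-- Layers V_1..V_{n-1} and V_n = {accept, reject} are identified with Fin 2
-- (zero = vertex (t,1), suc zero = vertex (t,2)); the single start vertex
-- (0,0) is the state `zero` at time 0 (outgoing edges of the other state at
-- time 0 are simply never used).  `edge t v b` is the endpoint in V_{t+1}
-- of the edge labelled b leaving vertex v of V_t.

record ROBP₂ (n : ℕ) : Set where
  field
    edge : Fin n → Fin 2 → Bool → Fin 2

run : ∀ {k} → (Fin k → Fin 2 → Bool → Fin 2) → Fin 2 → Input k → Fin 2
run {zero}  e v x = v
run {suc k} e v x = run (λ t → e (suc t)) (e zero v (x zero)) (λ t → x (suc t))

isZero : Fin 2 → Bool
isZero zero = true
isZero (suc _) = false

-- accepted iff the path ends at (n,1)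
evalBP : ∀ {n} → ROBP₂ n → BoolFn n
evalBP B x = isZero (run (ROBP₂.edge B) zero x)

ComputableByWidth2ROBP : ∀ {n} → BoolFn n → Set
ComputableByWidth2ROBP {n} f = Σ (ROBP₂ n) (λ B → ∀ x → evalBP B x ≡ f x)

VarSet : ℕ → Set
VarSet n = Fin n → Bool

DependsOnlyOn : ∀ {n} → BoolFn n → VarSet n → Set
DependsOnlyOn {n} f S = ∀ (x y : Input n) → (∀ j → S j ≡ true → x j ≡ y j) → f x ≡ f y

DisjointSets : ∀ {n} → VarSet n → VarSet n → Set
DisjointSets S T = ∀ j → S j ≡ true → T j ≡ true → ⊥

bigAnd : ∀ {n m} → (Fin m → BoolFn n) → BoolFn n
bigAnd {m = zero}  fs x = true
bigAnd {m = suc m} fs x = fs zero x ∧ bigAnd (λ i → fs (suc i)) x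

Literal : ℕ → Set
Literal n = Fin n × Bool

evalLit : ∀ {n} → Literal n → Input n → Bool
evalLit (j , true)  x = x j
evalLit (j , false) x = not (x j)

data Term (n : ℕ) : Set where
  clause : List (Literal n) → Term n
  parity : List (Literal n) → Term n

evalTerm : ∀ {n} → Term n → Input n → Bool
evalTerm (clause ls) x = foldr (λ l b → evalLit l x ∨ b) false ls
evalTerm (parity ls) x = foldr (λ l b → evalLit l x xor b) false ls

termVars : ∀ {n} → Term n → List (Fin n)
termVars (clause ls) = map proj₁ ls
termVars (parity ls) = map proj₁ ls

DisjointTerms : ∀ {n} → Term n → Term n → Set
DisjointTerms T T' = ∀ j → j ∈ termVars T → j ∈ termVars T' → ⊥

record CNF⊕ (n : ℕ) : Set where
  field
    terms    : List (Term n)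
    disjoint : AllPairs DisjointTerms terms

evalCNF⊕ : ∀ {n} → CNF⊕ n → BoolFn n
evalCNF⊕ φ x = foldr (λ T b → evalTerm T x ∧ b) true (CNF⊕.terms φ)

count : ∀ n → BoolFn n → ℕ
count zero    f = if f (λ ()) then 1 else 0
count (suc n) f = count n (λ x → f (false ∷ᶠ x)) Data.Nat.+ count n (λ x → f (true ∷ᶠ x))
  where import Data.Nat

𝔼 : ∀ {n} → BoolFn n → ℚ
𝔼 {n} f = _/_ (+ count n f) (2 ^ n) {{m^n≢0 2 n}}

_^ℚ_ : ℚ → ℕ → ℚ
q ^ℚ zero  = 1ℚ
q ^ℚ suc k = q * (q ^ℚ k)

_≤fn_ : ∀ {n} → BoolFn n → BoolFn n → Set
g ≤fn f = ∀ x → g x ≡ true → f x ≡ true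

module Submission where

-- Formulas, Compilation: the bit "the current state is (t,1)" is mapped by
--   each layer through a constant, the identity or negation, chosen by the
--   input bit, so the program computes a formula of the grammar
--       F ::= b  |  if ℓ then b else F  |  x_j ⊕ F
--   where each subformula reads only variables before the one tested.
-- Approximation: every such F has a CNF⊕ g ≤ F with 𝔼[F]³ ≤ 𝔼[g].  ¬ℓ ∧ F
--   is approximated by ¬ℓ ∧ g (both means halve); a maximal disjunction
--   ℓ₁ ∨ ⋯ ∨ ℓ_r ∨ R by the clause ℓ₁ ∨ ⋯ ∨ ℓ_r, as R is false with
--   probability ≥ 1/2; x_j ⊕ F (mean 1/2) by a literal ∧ parity (mean 1/4).
-- Blocks, Rationals: means multiply over disjoint blocks, so the block
--   approximations conjoin; finally the bound on counts is read in ℚ.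

module Counting where

  open import Defs
  open import Data.Bool using (Bool; true; false; not; _∧_; _xor_; if_then_else_)
  open import Data.Bool.Properties using (∧-comm; not-involutive; xor-identityʳ)
  open import Data.Nat using (ℕ; zero; suc; _+_; _*_; _^_; _≤_; z≤n; s≤s)
  open import Data.Nat.Properties
  open import Data.Fin using (Fin; zero; suc)
  open import Data.Vec.Functional using () renaming (_∷_ to _∷ᶠ_)
  open import Data.Product using (_,_; proj₁)
  open import Data.Empty using (⊥-elim)
  open import Relation.Binary.PropositionalEquality
  open import Data.Nat.Tactic.RingSolver using (solve-∀)

  indicator : Bool → ℕ
  indicator b = if b then 1 else 0

  pow2-suc : ∀ n → 2 ^ suc n ≡ 2 ^ n + 2 ^ n
  pow2-suc n = cong (2 ^ n +_) (+-identityʳ (2 ^ n))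

  count-cong : ∀ n {f g : BoolFn n} → (∀ x → f x ≡ g x) → count n f ≡ count n g
  count-cong zero    eq = cong indicator (eq _)
  count-cong (suc n) eq = cong₂ _+_ (count-cong n (λ x → eq _)) (count-cong n (λ x → eq _))

  count-≤ : ∀ n (f : BoolFn n) → count n f ≤ 2 ^ n
  count-≤ zero    f = indicator≤1 (f _)
    where
    indicator≤1 : ∀ b → indicator b ≤ 1
    indicator≤1 false = z≤n
    indicator≤1 true  = s≤s z≤n
  count-≤ (suc n) f = subst (count (suc n) f ≤_) (sym (pow2-suc n))
    (+-mono-≤ (count-≤ n (λ x → f (false ∷ᶠ x))) (count-≤ n (λ x → f (true ∷ᶠ x))))

  count-mono : ∀ n (f g : BoolFn n) → f ≤fn g → count n f ≤ count n g
  count-mono zero    f g h = indicator-mono (f _) (g _) (h _)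
    where
    indicator-mono : ∀ a b → (a ≡ true → b ≡ true) → indicator a ≤ indicator b
    indicator-mono false b _ = z≤n
    indicator-mono true  b h rewrite h refl = s≤s z≤n
  count-mono (suc n) f g h = +-mono-≤ (count-mono n _ _ (λ x → h _)) (count-mono n _ _ (λ x → h _))

  count-complement : ∀ n (f : BoolFn n) → count n (λ x → not (f x)) + count n f ≡ 2 ^ n
  count-complement zero f = indicator-not (f _)
    where
    indicator-not : ∀ b → indicator (not b) + indicator b ≡ 1
    indicator-not false = refl
    indicator-not true  = refl
  count-complement (suc n) f = begin
      (a + b) + (c + d) ≡⟨ interchange a b c d ⟩
      (a + c) + (b + d) ≡⟨ cong₂ _+_ (count-complement n (λ x → f (false ∷ᶠ x)))
                                     (count-complement n (λ x → f (true ∷ᶠ x))) ⟩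
      2 ^ n + 2 ^ n     ≡⟨ sym (pow2-suc n) ⟩
      2 ^ suc n         ∎
    where
    open ≡-Reasoning
    a = count n (λ x → not (f (false ∷ᶠ x)))
    b = count n (λ x → not (f (true ∷ᶠ x)))
    c = count n (λ x → f (false ∷ᶠ x))
    d = count n (λ x → f (true ∷ᶠ x))
    interchange : ∀ a b c d → (a + b) + (c + d) ≡ (a + c) + (b + d)
    interchange = solve-∀
  complement-disjoint : ∀ {n} (V : VarSet n) → DisjointSets (λ i → not (V i)) V
  complement-disjoint V i outside inside with V i
  complement-disjoint V i () inside | true

  depends-mono : ∀ {n} {f : BoolFn n} {V W : VarSet n} →
    (∀ i → V i ≡ true → W i ≡ true) → DependsOnlyOn f V → DependsOnlyOn f W
  depends-mono V⊆W d x y eq = d x y (λ i v → eq i (V⊆W i v))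

  depends-not : ∀ {n} {f : BoolFn n} {V} → DependsOnlyOn f V → DependsOnlyOn (λ x → not (f x)) V
  depends-not d x y eq = cong not (d x y eq)

  depends-tail : ∀ {n} {f : BoolFn (suc n)} {S} → DependsOnlyOn f S → (b : Bool) →
    DependsOnlyOn (λ y → f (b ∷ᶠ y)) (λ i → S (suc i))
  depends-tail d b x y eq = d (b ∷ᶠ x) (b ∷ᶠ y) λ { zero _ → refl ; (suc i) s → eq i s }

  ignores-head : ∀ {n} {f : BoolFn (suc n)} {S} → DependsOnlyOn f S → S zero ≡ false →
    ∀ y → f (false ∷ᶠ y) ≡ f (true ∷ᶠ y)
  ignores-head {S = S} d s₀ y = d _ _ agree
    where
    agree : ∀ i → S i ≡ true → (false ∷ᶠ y) i ≡ (true ∷ᶠ y) i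
    agree zero s with trans (sym s₀) s
    ... | ()
    agree (suc i) _ = refl

  count-∧-step : ∀ n (f g : BoolFn (suc n)) → (∀ y → g (false ∷ᶠ y) ≡ g (true ∷ᶠ y)) →
    (∀ b → count n (λ y → f (b ∷ᶠ y) ∧ g (b ∷ᶠ y)) * 2 ^ n
           ≡ count n (λ y → f (b ∷ᶠ y)) * count n (λ y → g (b ∷ᶠ y))) →
    count (suc n) (λ x → f x ∧ g x) * 2 ^ suc n ≡ count (suc n) f * count (suc n) g
  count-∧-step n f g g-ignores halves = begin
      (A + B) * 2 ^ suc n                       ≡⟨ cong ((A + B) *_) (pow2-suc n) ⟩
      (A + B) * (N + N)                         ≡⟨ expand A B N ⟩
      (A * N + B * N) + (A * N + B * N)         ≡⟨ cong₂ (λ u v → (u + v) + (u + v)) (halves false)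
                                                         (trans (halves true) (cong (f₁ *_) (sym g₀≡g₁))) ⟩
      (f₀ * g₀ + f₁ * g₀) + (f₀ * g₀ + f₁ * g₀) ≡⟨ factor f₀ f₁ g₀ ⟩
      (f₀ + f₁) * (g₀ + g₀)                     ≡⟨ cong (λ u → (f₀ + f₁) * (g₀ + u)) g₀≡g₁ ⟩
      (f₀ + f₁) * (g₀ + g₁)                     ∎
    where
    open ≡-Reasoning
    N  = 2 ^ n
    A  = count n (λ y → f (false ∷ᶠ y) ∧ g (false ∷ᶠ y))
    B  = count n (λ y → f (true ∷ᶠ y) ∧ g (true ∷ᶠ y))
    f₀ = count n (λ y → f (false ∷ᶠ y))
    f₁ = count n (λ y → f (true ∷ᶠ y))
    g₀ = count n (λ y → g (false ∷ᶠ y))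
    g₁ = count n (λ y → g (true ∷ᶠ y))
    g₀≡g₁ : g₀ ≡ g₁
    g₀≡g₁ = count-cong n g-ignores
    expand : ∀ A B N → (A + B) * (N + N) ≡ (A * N + B * N) + (A * N + B * N)
    expand = solve-∀
    factor : ∀ a b c → (a * c + b * c) + (a * c + b * c) ≡ (a + b) * (c + c)
    factor = solve-∀

  count-∧-independent : ∀ n (f g : BoolFn n) S T → DependsOnlyOn f S → DependsOnlyOn g T →
    DisjointSets S T → count n (λ x → f x ∧ g x) * 2 ^ n ≡ count n f * count n g
  count-∧-independent zero f g S T df dg dj = indicator-∧ (f _) (g _)
    where
    indicator-∧ : ∀ a b → indicator (a ∧ b) * 1 ≡ indicator a * indicator b
    indicator-∧ false b     = refl
    indicator-∧ true  false = refl
    indicator-∧ true  true  = refl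
  -- the first variable is outside T, or else outside S (then swap f and g)
  count-∧-independent (suc n) f g S T df dg dj with T zero in T₀ | S zero in S₀
  ... | false | _     = count-∧-step n f g (ignores-head dg T₀) (λ b →
        count-∧-independent n _ _ _ _ (depends-tail df b) (depends-tail dg b) (λ j → dj (suc j)))
  ... | true  | true  = ⊥-elim (dj zero S₀ T₀)
  ... | true  | false = begin
      count (suc n) (λ x → f x ∧ g x) * 2 ^ suc n
        ≡⟨ cong (_* 2 ^ suc n) (count-cong (suc n) (λ x → ∧-comm (f x) (g x))) ⟩
      count (suc n) (λ x → g x ∧ f x) * 2 ^ suc n
        ≡⟨ count-∧-step n g f (ignores-head df S₀) (λ b → count-∧-independent n _ _ _ _
             (depends-tail dg b) (depends-tail df b) (λ j t s → dj (suc j) s t)) ⟩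
      count (suc n) g * count (suc n) f
        ≡⟨ *-comm (count (suc n) g) (count (suc n) f) ⟩
      count (suc n) f * count (suc n) g ∎
    where open ≡-Reasoning

  literal-dep : ∀ {n} (l : Literal n) x y → x (proj₁ l) ≡ y (proj₁ l) → evalLit l x ≡ evalLit l y
  literal-dep (j , true)  x y e = e
  literal-dep (j , false) x y e = cong not e

  literal-xor : ∀ {n} (j : Fin n) pol x → evalLit (j , pol) x ≡ x j xor not pol
  literal-xor j true  x = sym (xor-identityʳ (x j))
  literal-xor j false x with x j
  ... | true  = refl
  ... | false = refl

  literal-not : ∀ {n} (j : Fin n) pol x → evalLit (j , not pol) x ≡ not (evalLit (j , pol) x)
  literal-not j true  x = refl
  literal-not j false x = sym (not-involutive (x j))

  count-xor-fresh : ∀ n (j : Fin n) (h : BoolFn n) S → DependsOnlyOn h S → S j ≡ false →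
    count n (λ x → x j xor h x) * 2 ≡ 2 ^ n
  count-xor-fresh (suc n) zero h S dh s = begin
      (c + count n (λ y → not (h (true ∷ᶠ y)))) * 2
        ≡⟨ cong (λ u → (c + u) * 2) (count-cong n (λ y → cong not (sym (ignores-head dh s y)))) ⟩
      (c + count n (λ y → not (h (false ∷ᶠ y)))) * 2
        ≡⟨ cong (_* 2) (trans (+-comm c _) (count-complement n (λ y → h (false ∷ᶠ y)))) ⟩
      2 ^ n * 2 ≡⟨ *-comm (2 ^ n) 2 ⟩
      2 ^ suc n ∎
    where
    open ≡-Reasoning
    c = count n (λ y → h (false ∷ᶠ y))
  count-xor-fresh (suc n) (suc j) h S dh s = begin
      (a + b) * 2     ≡⟨ *-distribʳ-+ 2 a b ⟩
      a * 2 + b * 2   ≡⟨ cong₂ _+_ (count-xor-fresh n j _ _ (depends-tail dh false) s)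
                                   (count-xor-fresh n j _ _ (depends-tail dh true) s) ⟩
      2 ^ n + 2 ^ n   ≡⟨ sym (pow2-suc n) ⟩
      2 ^ suc n       ∎
    where
    open ≡-Reasoning
    a = count n (λ y → y j xor h (false ∷ᶠ y))
    b = count n (λ y → y j xor h (true ∷ᶠ y))

  count-literal : ∀ n (j : Fin n) pol → count n (evalLit (j , pol)) * 2 ≡ 2 ^ n
  count-literal n j pol = trans (cong (_* 2) (count-cong n (literal-xor j pol)))
    (count-xor-fresh n j (λ _ → not pol) (λ _ → false) (λ _ _ _ → refl) refl)

  count-literal-∧ : ∀ n (j : Fin n) pol (h : BoolFn n) V → DependsOnlyOn h V → V j ≡ false →
    count n (λ x → evalLit (j , pol) x ∧ h x) * 2 ≡ count n h
  count-literal-∧ n j pol h V dh v = *-cancelʳ-≡ (a * 2) c N {{m^n≢0 2 n}} (begin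
      a * 2 * N ≡⟨ swap₂ a 2 N ⟩
      a * N * 2 ≡⟨ cong (_* 2) (count-∧-independent n _ h _ V dl dh (complement-disjoint V)) ⟩
      l * c * 2 ≡⟨ swap₂ l c 2 ⟩
      l * 2 * c ≡⟨ cong (_* c) (count-literal n j pol) ⟩
      N * c     ≡⟨ *-comm N c ⟩
      c * N     ∎)
    where
    open ≡-Reasoning
    N = 2 ^ n
    a = count n (λ x → evalLit (j , pol) x ∧ h x)
    l = count n (evalLit (j , pol))
    c = count n h
    dl : DependsOnlyOn (evalLit (j , pol)) (λ i → not (V i))
    dl x y eq = literal-dep (j , pol) x y (eq j (cong not v))
    swap₂ : ∀ p q r → p * q * r ≡ p * r * q
    swap₂ = solve-∀

module Terms where

  open import Defs
  open Counting using (literal-dep; literal-xor; complement-disjoint)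
  open import Data.Bool using (Bool; true; false; not; _∧_; _∨_; _xor_; T)
  open import Data.Bool.Properties using (∧-assoc; xor-assoc; xor-comm; not-involutive)
  open import Data.Nat using (ℕ; _<_; _≤_; _<?_)
  open import Data.Nat.Properties using (<-≤-trans; ≤⇒≯; <ᵇ⇒<)
  open import Data.Fin using (Fin; toℕ)
  open import Data.List using (List; []; _∷_; foldr; map; _++_)
  open import Data.List.Relation.Unary.All as All using (All; []; _∷_)
  open import Data.List.Membership.Propositional using (_∈_)
  open import Data.List.Membership.Propositional.Properties using (∈-map⁻)
  open import Data.Product using (_,_; proj₁)
  open import Relation.Nullary.Decidable using (does; dec-true; dec-false)
  open import Relation.Binary.PropositionalEquality

  module _ {n : ℕ} where

    below : ℕ → VarSet n
    below k i = does (toℕ i <? k)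

    atLeast : ℕ → VarSet n
    atLeast k i = not (below k i)

    below-in : ∀ {k} (i : Fin n) → toℕ i < k → below k i ≡ true
    below-in {k} i = dec-true (toℕ i <? k)

    below-out : ∀ {k} (i : Fin n) → below k i ≡ true → toℕ i < k
    below-out {k} i b = <ᵇ⇒< (toℕ i) k (subst T (sym b) _)

    below-false : ∀ {k} (i : Fin n) → k ≤ toℕ i → below k i ≡ false
    below-false {k} i k≤i = dec-false (toℕ i <? k) (≤⇒≯ k≤i)

    atLeast-in : ∀ {k} (i : Fin n) → k ≤ toℕ i → atLeast k i ≡ true
    atLeast-in i k≤i = cong not (below-false i k≤i)

    below-mono : ∀ {k k₂} → k ≤ k₂ → ∀ i → below k i ≡ true → below k₂ i ≡ true
    below-mono k≤k₂ i b = below-in i (<-≤-trans (below-out i b) k≤k₂)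

    below-atLeast-disjoint : ∀ k → DisjointSets (below k) (atLeast k)
    below-atLeast-disjoint k i b a = complement-disjoint (below k) i a b

    atLeast-below-disjoint : ∀ k → DisjointSets (atLeast k) (below k)
    atLeast-below-disjoint k = complement-disjoint (below k)

    lits : Term n → List (Literal n)
    lits (clause ls) = ls
    lits (parity ls) = ls

    termVars-lits : ∀ (t : Term n) → termVars t ≡ map proj₁ (lits t)
    termVars-lits (clause ls) = refl
    termVars-lits (parity ls) = refl

    LitsIn : VarSet n → List (Literal n) → Set
    LitsIn V ls = All (λ l → V (proj₁ l) ≡ true) ls

    TermsIn : VarSet n → List (Term n) → Set
    TermsIn V ts = All (λ t → LitsIn V (lits t)) ts

    litsIn-mono : ∀ {V W} → (∀ i → V i ≡ true → W i ≡ true) → ∀ {ls} → LitsIn V ls → LitsIn W ls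
    litsIn-mono V⊆W = All.map (λ {l} v → V⊆W (proj₁ l) v)

    termsIn-mono : ∀ {V W} → (∀ i → V i ≡ true → W i ≡ true) → ∀ {ts} → TermsIn V ts → TermsIn W ts
    termsIn-mono V⊆W = All.map (litsIn-mono V⊆W)

    evalTerms : List (Term n) → BoolFn n
    evalTerms ts x = foldr (λ T b → evalTerm T x ∧ b) true ts

    evalTerms-++ : ∀ (ts us : List (Term n)) x → evalTerms (ts ++ us) x ≡ evalTerms ts x ∧ evalTerms us x
    evalTerms-++ []       us x = refl
    evalTerms-++ (t ∷ ts) us x =
      trans (cong (evalTerm t x ∧_) (evalTerms-++ ts us x)) (sym (∧-assoc (evalTerm t x) _ _))

    term-depends : ∀ {V} (t : Term n) → LitsIn V (lits t) → DependsOnlyOn (evalTerm t) V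
    term-depends (clause [])       _        x y eq = refl
    term-depends (clause (l ∷ ls)) (v ∷ vs) x y eq =
      cong₂ _∨_ (literal-dep l x y (eq _ v)) (term-depends (clause ls) vs x y eq)
    term-depends (parity [])       _        x y eq = refl
    term-depends (parity (l ∷ ls)) (v ∷ vs) x y eq =
      cong₂ _xor_ (literal-dep l x y (eq _ v)) (term-depends (parity ls) vs x y eq)

    terms-depend : ∀ {V} (ts : List (Term n)) → TermsIn V ts → DependsOnlyOn (evalTerms ts) V
    terms-depend []       _        x y eq = refl
    terms-depend (t ∷ ts) (v ∷ vs) x y eq = cong₂ _∧_ (term-depends t v x y eq) (terms-depend ts vs x y eq)

    disjoint-terms : ∀ {V W} → DisjointSets V W → ∀ (t u : Term n) →
      LitsIn V (lits t) → LitsIn W (lits u) → DisjointTerms t u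
    disjoint-terms {V} {W} dj t u vt wu j j∈t j∈u
      with ∈-map⁻ proj₁ (subst (j ∈_) (termVars-lits t) j∈t)
         | ∈-map⁻ proj₁ (subst (j ∈_) (termVars-lits u) j∈u)
    ... | l , l∈t , refl | m , m∈u , refl = dj j (All.lookup vt l∈t) (All.lookup wu m∈u)

    xorTerm : Fin n → Bool → List (Literal n) → Term n
    xorTerm j b P = parity ((j , not b) ∷ P)

    xorTerm-eval : ∀ j b P x → evalTerm (xorTerm j b P) x ≡ x j xor (evalTerm (parity P) x xor b)
    xorTerm-eval j b P x = begin
      evalLit (j , not b) x xor p  ≡⟨ cong (_xor p) (literal-xor j (not b) x) ⟩
      (x j xor not (not b)) xor p  ≡⟨ cong (λ c → (x j xor c) xor p) (not-involutive b) ⟩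
      (x j xor b) xor p            ≡⟨ xor-assoc (x j) b p ⟩
      x j xor (b xor p)            ≡⟨ cong (x j xor_) (xor-comm b p) ⟩
      x j xor (p xor b)            ∎
      where
      open ≡-Reasoning
      p = evalTerm (parity P) x

    disjoint-term-lists : ∀ {V W} → DisjointSets V W → ∀ {ts us} → TermsIn V ts → TermsIn W us →
      All (λ t → All (DisjointTerms t) us) ts
    disjoint-term-lists dj vts wus =
      All.map (λ {t} vt → All.map (λ {u} wu → disjoint-terms dj t u vt wu) wus) vts

module Formulas where

  open import Defs
  open Counting using (literal-dep)
  open Terms using (below; below-in; below-mono)
  open import Data.Bool using (Bool; true; false; not; _xor_; if_then_else_)
  open import Data.Bool.Properties using (not-involutive)
  open import Data.Nat using (ℕ; suc; _<_; _≤_; z≤n)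
  open import Data.Nat.Properties using (≤-trans; <⇒≤; <-≤-trans; n≤1+n)
  open import Data.Fin using (Fin; toℕ)
  open import Data.Product using (_,_)
  open import Relation.Binary.PropositionalEquality

  module _ {n : ℕ} (S : VarSet n) where

    -- Fm k: formulas on the variables of S of index below k.  The
    -- subformula of a node reads only variables before the one it tests.
    data Fm : ℕ → Set where
      const  : ∀ {k} → Bool → Fm k
      ifLit  : ∀ {k k'} (j : Fin n) → toℕ j < k → k' ≤ toℕ j → S j ≡ true →
               (pol out : Bool) → Fm k' → Fm k
      xorVar : ∀ {k k'} (j : Fin n) → toℕ j < k → k' ≤ toℕ j → S j ≡ true →
               Fm k' → Fm k

    sem : ∀ {k} → Fm k → BoolFn n
    sem (const b)                 x = b
    sem (ifLit j _ _ _ pol out F) x = if evalLit (j , pol) x then out else sem F x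
    sem (xorVar j _ _ _ F)        x = x j xor sem F x

    sem-depends : ∀ {k} (F : Fm k) → DependsOnlyOn (sem F) (below k)
    sem-depends (const b) x y eq = refl
    sem-depends (ifLit j j<k k'≤j _ pol out F) x y eq =
      cong₂ (λ l v → if l then out else v) (literal-dep (j , pol) x y (eq j (below-in j j<k)))
            (sem-depends F x y (λ i b → eq i (below-mono (≤-trans k'≤j (<⇒≤ j<k)) i b)))
    sem-depends (xorVar j j<k k'≤j _ F) x y eq =
      cong₂ _xor_ (eq j (below-in j j<k))
            (sem-depends F x y (λ i b → eq i (below-mono (≤-trans k'≤j (<⇒≤ j<k)) i b)))

    neg : ∀ {k} → Fm k → Fm k
    neg (const b)                 = const (not b)
    neg (ifLit j p q s pol out F) = ifLit j p q s pol (not out) (neg F)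
    neg (xorVar j p q s F)        = xorVar j p q s (neg F)

    neg-sem : ∀ {k} (F : Fm k) x → sem (neg F) x ≡ not (sem F x)
    neg-sem (const b) x = refl
    neg-sem (ifLit j _ _ _ pol out F) x with evalLit (j , pol) x
    ... | true  = refl
    ... | false = neg-sem F x
    neg-sem (xorVar j _ _ _ F) x rewrite neg-sem F x with x j
    ... | true  = refl
    ... | false = refl

    weaken : ∀ {k k₂} → k ≤ k₂ → Fm k → Fm k₂
    weaken le (const b)                 = const b
    weaken le (ifLit j p q s pol out F) = ifLit j (<-≤-trans p le) q s pol out F
    weaken le (xorVar j p q s F)        = xorVar j (<-≤-trans p le) q s F

    weaken-sem : ∀ {k k₂} (le : k ≤ k₂) (F : Fm k) x → sem (weaken le F) x ≡ sem F x
    weaken-sem le (const b)                 x = refl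
    weaken-sem le (ifLit j p q s pol out F) x = refl
    weaken-sem le (xorVar j p q s F)        x = refl

  -- The maps Bool → Bool: constant, or v ↦ s ⊕ v (identity or negation).
  data Map₁ : Set where
    constant shift : Bool → Map₁

  apply : Map₁ → Bool → Bool
  apply (constant c) v = c
  apply (shift s)    v = s xor v

  tabulate : Bool → Bool → Map₁
  tabulate true  true  = constant true
  tabulate false false = constant false
  tabulate true  false = shift false
  tabulate false true  = shift true

  tabulate-apply : ∀ α β v → apply (tabulate α β) v ≡ (if v then α else β)
  tabulate-apply true  true  true  = refl
  tabulate-apply true  true  false = refl
  tabulate-apply false false true  = refl
  tabulate-apply false false false = refl
  tabulate-apply true  false true  = refl
  tabulate-apply true  false false = refl
  tabulate-apply false true  true  = refl
  tabulate-apply false true  false = refl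

  module _ {n : ℕ} {S : VarSet n} where

    mapFm : ∀ {k} → Map₁ → Fm S k → Fm S k
    mapFm (constant c) F = const c
    mapFm (shift false) F = F
    mapFm (shift true) F = neg S F

    mapFm-sem : ∀ {k} σ (F : Fm S k) x → sem S (mapFm σ F) x ≡ apply σ (sem S F x)
    mapFm-sem (constant c)  F x = refl
    mapFm-sem (shift false) F x = refl
    mapFm-sem (shift true)  F x = neg-sem S F x

    layer : ∀ {k} (j : Fin n) → toℕ j < suc k → k ≤ toℕ j → S j ≡ true →
      (σ₀ σ₁ : Map₁) → Fm S k → Fm S (suc k)
    layer j p q s (constant c₀) (constant c₁) F = ifLit j p z≤n s true c₁ (const {k = 0} c₀)
    layer j p q s (constant c₀) σ₁            F = ifLit j p q s false c₀ (mapFm σ₁ F)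
    layer j p q s (shift s₀)    (constant c₁) F = ifLit j p q s true c₁ (mapFm (shift s₀) F)
    layer j p q s (shift false) (shift false) F = weaken S (n≤1+n _) F
    layer j p q s (shift true)  (shift true)  F = weaken S (n≤1+n _) (neg S F)
    layer j p q s (shift false) (shift true)  F = xorVar j p q s F
    layer j p q s (shift true)  (shift false) F = xorVar j p q s (neg S F)

    layer-sem : ∀ {k} j p q s σ₀ σ₁ (F : Fm S k) x →
      sem S (layer j p q s σ₀ σ₁ F) x ≡ (if x j then apply σ₁ (sem S F x) else apply σ₀ (sem S F x))
    layer-sem j p q s (constant c₀) (constant c₁) F x with x j
    ... | true  = refl
    ... | false = refl
    layer-sem j p q s (constant c₀) (shift s₁) F x with x j
    ... | true  = mapFm-sem (shift s₁) F x
    ... | false = refl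
    layer-sem j p q s (shift s₀) (constant c₁) F x with x j
    ... | true  = refl
    ... | false = mapFm-sem (shift s₀) F x
    layer-sem j p q s (shift false) (shift false) F x with x j
    ... | true  = weaken-sem S _ F x
    ... | false = weaken-sem S _ F x
    layer-sem j p q s (shift true) (shift true) F x with x j
    ... | true  = trans (weaken-sem S _ (neg S F) x) (neg-sem S F x)
    ... | false = trans (weaken-sem S _ (neg S F) x) (neg-sem S F x)
    layer-sem j p q s (shift false) (shift true) F x with x j
    ... | true  = refl
    ... | false = refl
    layer-sem j p q s (shift true) (shift false) F x with x j
    ... | true  = trans (cong not (neg-sem S F x)) (not-involutive (sem S F x))
    ... | false = neg-sem S F x

module Compilation where

  open import Defs
  open Formulas
  open import Data.Bool using (Bool; true; false; if_then_else_)
  open import Data.Nat using (ℕ; zero; suc; _≤_)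
  open import Data.Nat.Properties using (≤-refl; ≤-reflexive; <⇒≤; n≤1+n)
  open import Data.Fin using (Fin; zero; suc; fromℕ<; fromℕ; inject₁; inject≤)
  open import Data.Fin.Properties
    using (toℕ-injective; toℕ-fromℕ<; toℕ-fromℕ; toℕ-inject₁; toℕ-inject≤; inject≤-refl)
  open import Data.Product using (Σ; _,_; proj₁; proj₂)
  open import Relation.Binary.PropositionalEquality

  -- how a layer M : Fin 2 → Fin 2 transforms the bit "the state is (t,1)"
  layerMap : (Fin 2 → Fin 2) → Map₁
  layerMap M = tabulate (isZero (M zero)) (isZero (M (suc zero)))

  layerMap-correct : ∀ M s → isZero (M s) ≡ apply (layerMap M) (isZero s)
  layerMap-correct M zero       = sym (tabulate-apply (isZero (M zero)) (isZero (M (suc zero))) true)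
  layerMap-correct M (suc zero) = sym (tabulate-apply (isZero (M zero)) (isZero (M (suc zero))) false)

  run-cong : ∀ {k} (e e' : Fin k → Fin 2 → Bool → Fin 2) v (x x' : Input k) →
    (∀ t v b → e t v b ≡ e' t v b) → (∀ t → x t ≡ x' t) → run e v x ≡ run e' v x'
  run-cong {zero}  e e' v x x' he hx = refl
  run-cong {suc k} e e' v x x' he hx rewrite he zero v (x zero) | hx zero =
    run-cong (λ t → e (suc t)) (λ t → e' (suc t)) _ _ _ (λ t → he (suc t)) (λ t → hx (suc t))

  run-snoc : ∀ k (e : Fin (suc k) → Fin 2 → Bool → Fin 2) v x →
    run e v x ≡ e (fromℕ k) (run (λ t → e (inject₁ t)) v (λ t → x (inject₁ t))) (x (fromℕ k))
  run-snoc zero    e v x = refl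
  run-snoc (suc k) e v x = run-snoc k (λ t → e (suc t)) (e zero v (x zero)) (λ t → x (suc t))

  run-relabel : ∀ {k} (E : Fin k → Fin 2 → Bool → Fin 2) (m : Fin k → Bool → Bool) v x →
    run (λ t v b → E t v (m t b)) v x ≡ run E v (λ t → m t (x t))
  run-relabel {zero}  E m v x = refl
  run-relabel {suc k} E m v x =
    run-relabel (λ t → E (suc t)) (λ t → m (suc t)) (E zero v (m zero (x zero))) (λ t → x (suc t))

  module _ {n : ℕ} (S : VarSet n) (e : Fin n → Fin 2 → Bool → Fin 2)
           (ignores : ∀ t v → S t ≡ false → e t v false ≡ e t v true) where

    state : (k : ℕ) → k ≤ n → Input n → Fin 2
    state zero    _ x = zero
    state (suc k) p x = e (fromℕ< p) (state k (<⇒≤ p) x) (x (fromℕ< p))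

    state-run : ∀ k (p : k ≤ n) x →
      state k p x ≡ run {k} (λ t → e (inject≤ t p)) zero (λ t → x (inject≤ t p))
    state-run zero    p x = refl
    state-run (suc k) p x =
      trans (cong₂ (λ j s → e j s (x j)) (sym last)
              (trans (state-run k p' x)
                     (run-cong _ _ zero _ _ (λ t v b → cong (λ i → e i v b) (sym (earlier t)))
                                            (λ t → cong x (sym (earlier t))))))
            (sym (run-snoc k (λ t → e (inject≤ t p)) zero (λ t → x (inject≤ t p))))
      where
      p' = <⇒≤ p
      last : inject≤ (fromℕ k) p ≡ fromℕ< p
      last = toℕ-injective (trans (toℕ-inject≤ _ p) (trans (toℕ-fromℕ k) (sym (toℕ-fromℕ< p))))
      earlier : ∀ t → inject≤ (inject₁ t) p ≡ inject≤ t p'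
      earlier t =
        toℕ-injective (trans (toℕ-inject≤ _ p) (trans (toℕ-inject₁ t) (sym (toℕ-inject≤ t p'))))

    run-state : ∀ x → run e zero x ≡ state n ≤-refl x
    run-state x = sym (trans (state-run n ≤-refl x)
      (run-cong _ _ zero _ _ (λ t v b → cong (λ i → e i v b) (inject≤-refl t _))
                             (λ t → cong x (inject≤-refl t _))))

    compile : (k : ℕ) (p : k ≤ n) → Σ (Fm S k) λ F → ∀ x → sem S F x ≡ isZero (state k p x)
    compile zero _ = const true , λ x → refl
    compile (suc k) p with compile k (<⇒≤ p) | S (fromℕ< p) in S-j
    ... | F , F-correct | true  = layer j j<1+k k≤j S-j (σ false) (σ true) F , G-correct
      where
      j = fromℕ< p
      j<1+k = ≤-reflexive (cong suc (toℕ-fromℕ< p))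
      k≤j = ≤-reflexive (sym (toℕ-fromℕ< p))
      σ : Bool → Map₁
      σ b = layerMap (λ v → e j v b)
      step : ∀ s b →
        isZero (e j s b) ≡ (if b then apply (σ true) (isZero s) else apply (σ false) (isZero s))
      step s true  = layerMap-correct (λ v → e j v true) s
      step s false = layerMap-correct (λ v → e j v false) s
      G-correct : ∀ x →
        sem S (layer j j<1+k k≤j S-j (σ false) (σ true) F) x ≡ isZero (state (suc k) p x)
      G-correct x = begin
        sem S (layer j j<1+k k≤j S-j (σ false) (σ true) F) x
          ≡⟨ layer-sem j j<1+k k≤j S-j (σ false) (σ true) F x ⟩
        (if x j then apply (σ true) (sem S F x) else apply (σ false) (sem S F x))
          ≡⟨ cong (λ v → if x j then apply (σ true) v else apply (σ false) v) (F-correct x) ⟩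
        (if x j then apply (σ true) (isZero s) else apply (σ false) (isZero s))
          ≡⟨ sym (step s (x j)) ⟩
        isZero (e j s (x j)) ∎
        where
        open ≡-Reasoning
        s = state k (<⇒≤ p) x
    -- a variable outside S: the layer applies the same map for both bits
    ... | F , F-correct | false = weaken S (n≤1+n k) (mapFm σ F) , G-correct
      where
      j = fromℕ< p
      σ = layerMap (λ v → e j v false)
      G-correct : ∀ x → sem S (weaken S (n≤1+n k) (mapFm σ F)) x ≡ isZero (state (suc k) p x)
      G-correct x = begin
        sem S (weaken S (n≤1+n k) (mapFm σ F)) x ≡⟨ weaken-sem S _ (mapFm σ F) x ⟩
        sem S (mapFm σ F) x                     ≡⟨ mapFm-sem σ F x ⟩
        apply σ (sem S F x)                     ≡⟨ cong (apply σ) (F-correct x) ⟩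
        apply σ (isZero s)                      ≡⟨ sym (layerMap-correct (λ v → e j v false) s) ⟩
        isZero (e j s false)                    ≡⟨ cong isZero (bit-ignored (x j)) ⟩
        isZero (e j s (x j))                    ∎
        where
        open ≡-Reasoning
        s = state k (<⇒≤ p) x
        bit-ignored : ∀ b → e j s false ≡ e j s b
        bit-ignored false = refl
        bit-ignored true  = ignores j s S-j

  compileROBP : ∀ {n} (f : BoolFn n) (S : VarSet n) →
    ComputableByWidth2ROBP f → DependsOnlyOn f S → Σ (Fm S n) λ F → ∀ x → sem S F x ≡ f x
  compileROBP {n} f S (B , B-computes) f-dep = proj₁ compiled , F-correct
    where
    E = ROBP₂.edge B
    mask : Fin n → Bool → Bool
    mask t b = if S t then b else false
    e : Fin n → Fin 2 → Bool → Fin 2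
    e t v b = E t v (mask t b)
    ignores : ∀ t v → S t ≡ false → e t v false ≡ e t v true
    ignores t v S-t rewrite S-t = refl
    compiled = compile S e ignores n ≤-refl
    mask-on-S : ∀ x t → S t ≡ true → mask t (x t) ≡ x t
    mask-on-S x t S-t rewrite S-t = refl
    F-correct : ∀ x → sem S (proj₁ compiled) x ≡ f x
    F-correct x = begin
      sem S (proj₁ compiled) x                  ≡⟨ proj₂ compiled x ⟩
      isZero (state S e ignores n ≤-refl x)     ≡⟨ cong isZero (sym (run-state S e ignores x)) ⟩
      isZero (run e zero x)                     ≡⟨ cong isZero (run-relabel E mask zero x) ⟩
      evalBP B (λ t → mask t (x t))             ≡⟨ B-computes _ ⟩
      f (λ t → mask t (x t))                    ≡⟨ f-dep _ x (mask-on-S x) ⟩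
      f x                                       ∎
      where open ≡-Reasoning

module CubeBounds where

  open import Data.Nat using (ℕ; _+_; _*_; _≤_; NonZero)
  open import Data.Nat.Properties
  open import Data.Product using (proj₁; proj₂)
  open import Function using (_$_)
  open import Relation.Binary.PropositionalEquality
  open import Data.Nat.Tactic.RingSolver using (solve-∀)

  cube : ℕ → ℕ
  cube c = c * (c * c)

  -- For counts c, g of functions on a cube with N points: (c/N)³ ≤ g/N.
  record CubeBound (N c g : ℕ) : Set where
    constructor cubeBound
    field
      cube≤ : cube c ≤ g * (N * N)

  cube-mono : ∀ {a b} → a ≤ b → cube a ≤ cube b
  cube-mono le = *-mono-≤ le (*-mono-≤ le le)

  cube-double : ∀ c → cube c * 8 ≡ cube (c * 2)
  cube-double = expanded
    where
    expanded : ∀ c → c * (c * c) * 8 ≡ (c * 2) * ((c * 2) * (c * 2))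
    expanded = solve-∀

  cubeBound-refl : ∀ {N c} → c ≤ N → CubeBound N c c
  cubeBound-refl {N} {c} c≤N = cubeBound (*-monoʳ-≤ c (*-mono-≤ c≤N c≤N))

  cubeBound-half : ∀ {N c c' g g'} → c' ≡ c * 2 → g' ≡ g * 2 → CubeBound N c' g' → CubeBound N c g
  cubeBound-half {N} {c} {g = g} refl refl (cubeBound bound) =
    cubeBound (*-cancelʳ-≤ (cube c) (g * (N * N)) 8 (begin
      cube c * 8          ≡⟨ cube-double c ⟩
      cube (c * 2)        ≤⟨ bound ⟩
      g * 2 * (N * N)     ≤⟨ m≤m*n (g * 2 * (N * N)) 4 ⟩
      g * 2 * (N * N) * 4 ≡⟨ regroup g (N * N) ⟩
      g * (N * N) * 8     ∎))
    where
    open ≤-Reasoning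
    regroup : ∀ g M → g * 2 * M * 4 ≡ g * M * 8
    regroup = solve-∀

  -- mean 1/2 approximated with mean 1/4: (1/2)³ ≤ 1/4
  cubeBound-quarter : ∀ {N c g h} → c * 2 ≡ N → g * 2 ≡ h → h * 2 ≡ N → CubeBound N c g
  cubeBound-quarter {N} {c} {g} refl refl 4g≡2c =
    cubeBound (*-cancelʳ-≤ (cube c) (g * (N * N)) 8 (begin
      cube c * 8        ≡⟨ cube-double c ⟩
      (c * 2) * M       ≡⟨ cong (_* M) (sym 4g≡2c) ⟩
      g * 2 * 2 * M     ≤⟨ m≤m*n (g * 2 * 2 * M) 2 ⟩
      g * 2 * 2 * M * 2 ≡⟨ regroup g M ⟩
      g * M * 8         ∎))
    where
    open ≤-Reasoning
    M = (c * 2) * (c * 2)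
    regroup : ∀ g M → g * 2 * 2 * M * 2 ≡ g * M * 8
    regroup = solve-∀

  -- (2g + B)³ ≤ 8 g (g + B)² when B ≤ g, written with g = B + s
  clause-inequality : ∀ B s → cube ((B + s) * 2 + B) ≤ (B + s) * ((B + s + B) * (B + s + B)) * 8
  clause-inequality B s = begin
      cube g₂                                    ≤⟨ m≤m+n _ _ ⟩
      cube g₂ + slack                            ≡⟨ identity B s ⟩
      (B + s) * ((B + s + B) * (B + s + B)) * 8  ∎
    where
    open ≤-Reasoning
    g₂ = (B + s) * 2 + B
    slack = B * (B * B) + 2 * (B * B * s) + 4 * (B * ((B + s) * (B + s)))
    identity : ∀ B s → ((B + s) * 2 + B) * (((B + s) * 2 + B) * ((B + s) * 2 + B))
                       + (B * (B * B) + 2 * (B * B * s) + 4 * (B * ((B + s) * (B + s))))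
                     ≡ (B + s) * ((B + s + B) * (B + s + B)) * 8
    identity = solve-∀

  -- The clause case, on counts: F = C ∨ R with C, R independent, where
  -- a = #¬F, b = #¬C ≤ N/2 and r = #¬R ≥ N/2.  In probabilities
  -- 𝔼F = 1 - (b/N)(r/N) ≤ 1 - b/2N, and (1 - β/2)³ ≤ 1 - β for β ≤ 1/2.
  cubeBound-clause : ∀ {N c a g b r} .{{_ : NonZero N}} → c + a ≡ N → g + b ≡ N → a * N ≡ b * r →
    N ≤ r * 2 → b * 2 ≤ N → CubeBound N c g
  cubeBound-clause {N} {c} {a} {g} {b} {r} c+a g+b a·N≡b·r N≤2r 2b≤N =
    cubeBound (*-cancelʳ-≤ (cube c) (g * (N * N)) 8 (begin
      cube c * 8                                 ≡⟨ cube-double c ⟩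
      cube (c * 2)                               ≤⟨ cube-mono 2c≤2g+b ⟩
      cube (g * 2 + b)                           ≡⟨ cong (λ z → cube (z * 2 + b)) (sym b+s) ⟩
      cube ((b + s) * 2 + b)                     ≤⟨ clause-inequality b s ⟩
      (b + s) * ((b + s + b) * (b + s + b)) * 8  ≡⟨ cong (λ z → (b + s) * (z * z) * 8) N≡g+s+b ⟩
      (b + s) * (N * N) * 8                      ≡⟨ cong (λ z → z * (N * N) * 8) b+s ⟩
      g * (N * N) * 8                            ∎))
    where
    open ≤-Reasoning
    b≤2a : b ≤ a * 2
    b≤2a = *-cancelʳ-≤ b (a * 2) N (begin
      b * N        ≤⟨ *-monoʳ-≤ b N≤2r ⟩
      b * (r * 2)  ≡⟨ sym (*-assoc b r 2) ⟩
      b * r * 2    ≡⟨ cong (_* 2) (sym a·N≡b·r) ⟩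
      a * N * 2    ≡⟨ swap₂ a N 2 ⟩
      a * 2 * N    ∎)
      where
      swap₂ : ∀ p q r → p * q * r ≡ p * r * q
      swap₂ = solve-∀
    b≤g : b ≤ g
    b≤g = +-cancelʳ-≤ b b g (begin
      b + b  ≡⟨ +-*2 b ⟩
      b * 2  ≤⟨ 2b≤N ⟩
      N      ≡⟨ sym g+b ⟩
      g + b  ∎)
      where
      +-*2 : ∀ b → b + b ≡ b * 2
      +-*2 = solve-∀
    2c≤2g+b : c * 2 ≤ g * 2 + b
    2c≤2g+b = +-cancelʳ-≤ b (c * 2) (g * 2 + b) (begin
      c * 2 + b      ≤⟨ +-monoʳ-≤ (c * 2) b≤2a ⟩
      c * 2 + a * 2  ≡⟨ sym (*-distribʳ-+ 2 c a) ⟩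
      (c + a) * 2    ≡⟨ cong (_* 2) (trans c+a (sym g+b)) ⟩
      (g + b) * 2    ≡⟨ expand g b ⟩
      g * 2 + b + b  ∎)
      where
      expand : ∀ g b → (g + b) * 2 ≡ g * 2 + b + b
      expand = solve-∀
    s = proj₁ (m≤n⇒∃[o]m+o≡n b≤g)
    b+s : b + s ≡ g
    b+s = proj₂ (m≤n⇒∃[o]m+o≡n b≤g)
    N≡g+s+b : b + s + b ≡ N
    N≡g+s+b = trans (cong (_+ b) b+s) g+b

  cubeBound-∧ : ∀ {N c c₁ c₂ g g₁ g₂} .{{_ : NonZero N}} → c * N ≡ c₁ * c₂ → g * N ≡ g₁ * g₂ →
    CubeBound N c₁ g₁ → CubeBound N c₂ g₂ → CubeBound N c g
  cubeBound-∧ {N} {c} {c₁} {c₂} {g} {g₁} {g₂} {{N≢0}} c-prod g-prod (cubeBound bound₁) (cubeBound bound₂) =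
    cubeBound $ *-cancelʳ-≤ (cube c) (g * (N * N)) (cube N) {{N³≢0}} (begin
      cube c * cube N                   ≡⟨ cube-* c N ⟩
      cube (c * N)                      ≡⟨ cong cube c-prod ⟩
      cube (c₁ * c₂)                    ≡⟨ sym (cube-* c₁ c₂) ⟩
      cube c₁ * cube c₂                 ≤⟨ *-mono-≤ bound₁ bound₂ ⟩
      (g₁ * (N * N)) * (g₂ * (N * N))   ≡⟨ regroup g₁ g₂ N ⟩
      (g₁ * g₂) * N * (N * (N * N))     ≡⟨ cong (λ z → z * N * (N * (N * N))) (sym g-prod) ⟩
      (g * N) * N * (N * (N * N))       ≡⟨ regroup′ g N ⟩
      g * (N * N) * cube N              ∎)
    where
    open ≤-Reasoning
    N³≢0 : NonZero (cube N)
    N³≢0 = m*n≢0 N (N * N) {{N≢0}} {{m*n≢0 N N {{N≢0}} {{N≢0}}}}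
    cube-* : ∀ a b → a * (a * a) * (b * (b * b)) ≡ (a * b) * ((a * b) * (a * b))
    cube-* = solve-∀
    regroup : ∀ a b N → (a * (N * N)) * (b * (N * N)) ≡ (a * b) * N * (N * (N * N))
    regroup = solve-∀
    regroup′ : ∀ g N → (g * N) * N * (N * (N * N)) ≡ g * (N * N) * (N * (N * N))
    regroup′ = solve-∀

module Approximation where

  open import Defs
  open Counting
  open Terms
  open Formulas
  open CubeBounds
  open import Data.Bool using (Bool; true; false; not; _∧_; _∨_; _xor_; if_then_else_)
  open import Data.Bool.Properties
    using (∨-zeroʳ; ∨-identityʳ; ∧-identityʳ; ∧-conicalˡ; ∧-conicalʳ; xor-assoc; not-distribʳ-xor)
  open import Data.Nat using (ℕ; _+_; _*_; _^_; _≤_; _<_; NonZero)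
  open import Data.Nat.Properties using (≤-refl; ≤-trans; <⇒≤; ≤-reflexive; +-comm; *-monoˡ-≤; m^n≢0)
  open import Data.Fin using (Fin; toℕ)
  open import Data.List using (List; []; _∷_)
  open import Data.List.Relation.Unary.All as All using (All; []; _∷_)
  open import Data.List.Relation.Unary.AllPairs using (AllPairs; []; _∷_)
  open import Data.Product using (_,_)
  open import Relation.Binary.PropositionalEquality

  module _ {n : ℕ} (S : VarSet n) where

    N : ℕ
    N = 2 ^ n

    instance
      N≢0 : NonZero N
      N≢0 = m^n≢0 2 n

    record Approx {k} (F : Fm S k) : Set where
      constructor approx
      field
        terms    : List (Term n)
        disjoint : AllPairs DisjointTerms terms
        inScope  : TermsIn (below k) terms
        inS      : TermsIn S terms
        sound    : evalTerms terms ≤fn sem S F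
        bound    : CubeBound N (count n (sem S F)) (count n (evalTerms terms))

    exact : ∀ {k} (F : Fm S k) ts → AllPairs DisjointTerms ts → TermsIn (below k) ts → TermsIn S ts →
      (∀ x → evalTerms ts x ≡ sem S F x) → Approx F
    exact F ts dj sc s eq = approx ts dj sc s (λ x h → trans (sym (eq x)) h)
      (subst (CubeBound N (count n (sem S F))) (count-cong n (λ x → sym (eq x)))
        (cubeBound-refl (count-≤ n _)))

    approx-andNot : ∀ {k k'} (j : Fin n) (j<k : toℕ j < k) (k'≤j : k' ≤ toℕ j) (s : S j ≡ true) pol
      (F : Fm S k') → Approx F → Approx (ifLit j j<k k'≤j s pol false F)
    approx-andNot {k} {k'} j j<k k'≤j s pol F (approx ts dj sc inS sound bound) =
      approx (ℓ ∷ ts) (ℓ-disjoint ∷ dj) ((below-in j j<k ∷ []) ∷ termsIn-mono below-k'⊆below-k sc)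
        ((s ∷ []) ∷ inS) sound' bound'
      where
      ¬ℓ = evalLit (j , not pol)
      ℓ = clause ((j , not pol) ∷ [])
      below-k'⊆below-k = below-mono (≤-trans k'≤j (<⇒≤ j<k))
      -- ℓ reads a variable of index at least k', the terms ts variables below k'
      ℓ-disjoint : All (DisjointTerms ℓ) ts
      ℓ-disjoint = All.map (λ {t} → disjoint-terms (atLeast-below-disjoint k') ℓ t (atLeast-in j k'≤j ∷ [])) sc
      unfold : ∀ x → sem S (ifLit j j<k k'≤j s pol false F) x ≡ ¬ℓ x ∧ sem S F x
      unfold x rewrite literal-not j pol x with evalLit (j , pol) x
      ... | true  = refl
      ... | false = refl
      unfold-terms : ∀ x → evalTerms (ℓ ∷ ts) x ≡ ¬ℓ x ∧ evalTerms ts x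
      unfold-terms x = cong (_∧ evalTerms ts x) (∨-identityʳ (¬ℓ x))
      sound' : evalTerms (ℓ ∷ ts) ≤fn sem S (ifLit j j<k k'≤j s pol false F)
      sound' x h rewrite unfold x | unfold-terms x =
        cong₂ _∧_ (∧-conicalˡ _ _ h) (sound x (∧-conicalʳ _ _ h))
      halves-F : count n (sem S (ifLit j j<k k'≤j s pol false F)) * 2 ≡ count n (sem S F)
      halves-F = trans (cong (_* 2) (count-cong n unfold))
        (count-literal-∧ n j (not pol) (sem S F) (below k') (sem-depends S F) (below-false j k'≤j))
      halves-g : count n (evalTerms (ℓ ∷ ts)) * 2 ≡ count n (evalTerms ts)
      halves-g = trans (cong (_* 2) (count-cong n unfold-terms))
        (count-literal-∧ n j (not pol) (evalTerms ts) (below k') (terms-depend ts sc) (below-false j k'≤j))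
      bound' : CubeBound N (count n (sem S (ifLit j j<k k'≤j s pol false F))) (count n (evalTerms (ℓ ∷ ts)))
      bound' = cubeBound-half (sym halves-F) (sym halves-g) bound

    -- What remains below a maximal disjunction of literals: a constant, or a
    -- function that is false on at least half of the inputs.
    data ClauseTail (f : BoolFn n) : Set where
      constant    : ∀ b → (∀ x → f x ≡ b) → ClauseTail f
      often-false : N ≤ count n (λ x → not (f x)) * 2 → ClauseTail f

    record ClauseSpine {k} (F : Fm S k) : Set where
      constructor clauseSpine
      field
        k'         : ℕ
        literals   : List (Literal n)
        rest       : Fm S k'
        k'≤k       : k' ≤ k
        lits-below : LitsIn (below k) literals
        lits-after : LitsIn (atLeast k') literals
        lits-S     : LitsIn S literals
        split      : ∀ x → sem S F x ≡ evalTerm (clause literals) x ∨ sem S rest x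
        tail       : ClauseTail (sem S rest)

    spine-or : ∀ {k k'} (j : Fin n) (j<k : toℕ j < k) (k'≤j : k' ≤ toℕ j) (s : S j ≡ true) pol
      (F : Fm S k') → ClauseSpine F → ClauseSpine (ifLit j j<k k'≤j s pol true F)
    spine-or j j<k k'≤j s pol F (clauseSpine k'' L R k''≤k' below-L after-L S-L split tail) =
      clauseSpine k'' ((j , pol) ∷ L) R (≤-trans k''≤k' (≤-trans k'≤j (<⇒≤ j<k)))
        (below-in j j<k ∷ litsIn-mono (below-mono (≤-trans k'≤j (<⇒≤ j<k))) below-L)
        (atLeast-in j (≤-trans k''≤k' k'≤j) ∷ after-L) (s ∷ S-L) split' tail
      where
      split' : ∀ x → (if evalLit (j , pol) x then true else sem S F x)
                     ≡ (evalLit (j , pol) x ∨ evalTerm (clause L) x) ∨ sem S R x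
      split' x with evalLit (j , pol) x
      ... | true  = refl
      ... | false = split x

    -- Unfold the disjunctions at the top of F.  Below them, a node
    -- if ℓ then false else _ is false wherever ℓ holds, and x_j ⊕ G is balanced.
    clauseSpineOf : ∀ {k} (F : Fm S k) → ClauseSpine F
    clauseSpineOf (ifLit j j<k k'≤j s pol true F) = spine-or j j<k k'≤j s pol F (clauseSpineOf F)
    clauseSpineOf {k} F@(const b) = clauseSpine k [] F ≤-refl [] [] [] (λ x → refl) (constant b (λ x → refl))
    clauseSpineOf {k} F@(ifLit j _ _ _ pol false _) =
      clauseSpine k [] F ≤-refl [] [] [] (λ x → refl) (often-false false-with-literal)
      where
      false-with-literal : N ≤ count n (λ x → not (sem S F x)) * 2
      false-with-literal = subst (_≤ count n (λ x → not (sem S F x)) * 2) (count-literal n j pol)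
        (*-monoˡ-≤ 2 (count-mono n _ _ λ x ℓ →
          subst (λ b → not (if b then false else _) ≡ true) (sym ℓ) refl))
    clauseSpineOf {k} F@(xorVar {k' = k'} j _ k'≤j _ G) =
      clauseSpine k [] F ≤-refl [] [] [] (λ x → refl) (often-false (≤-reflexive (sym balanced)))
      where
      -- ¬(x_j ⊕ G) = x_j ⊕ ¬G with x_j fresh for ¬G
      balanced : count n (λ x → not (sem S F x)) * 2 ≡ N
      balanced = trans (cong (_* 2) (count-cong n (λ x → not-distribʳ-xor (x j) (sem S G x))))
        (count-xor-fresh n j (λ x → not (sem S G x)) (below k') (depends-not (sem-depends S G))
          (below-false j k'≤j))

    approx-clause : ∀ {k} (F : Fm S k) (σ : ClauseSpine F) →
      count n (λ x → not (evalTerm (clause (ClauseSpine.literals σ)) x)) * 2 ≤ N → Approx F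
    approx-clause F (clauseSpine _ _ _ _ _ _ _ split (constant true R≡)) _ =
      exact F [] [] [] [] (λ x → sym (trans (split x) (trans (cong (_ ∨_) (R≡ x)) (∨-zeroʳ _))))
    approx-clause F (clauseSpine _ L _ _ below-L _ S-L split (constant false R≡)) _ =
      exact F (clause L ∷ []) ([] ∷ []) (below-L ∷ []) (S-L ∷ [])
        (λ x → trans (∧-identityʳ _) (sym (trans (split x) (trans (cong (_ ∨_) (R≡ x)) (∨-identityʳ _)))))
    approx-clause F (clauseSpine k' L R _ below-L after-L S-L split (often-false R-often-false)) C-often-true =
      approx (C ∷ []) ([] ∷ []) (below-L ∷ []) (S-L ∷ []) sound
        (cubeBound-clause F+¬F C+¬C independent R-often-false C-often-true)
      where
      C = clause L
      F+¬F : count n (sem S F) + count n (λ x → not (sem S F x)) ≡ N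
      F+¬F = trans (+-comm (count n (sem S F)) _) (count-complement n (sem S F))
      C+¬C : count n (evalTerms (C ∷ [])) + count n (λ x → not (evalTerm C x)) ≡ N
      C+¬C = trans (cong (_+ count n (λ x → not (evalTerm C x))) (count-cong n (λ x → ∧-identityʳ (evalTerm C x))))
                   (trans (+-comm (count n (evalTerm C)) _) (count-complement n (evalTerm C)))
      sound : evalTerms (C ∷ []) ≤fn sem S F
      sound x h rewrite split x | ∧-conicalˡ (evalTerm C x) true h = refl
      -- ¬F = ¬C ∧ ¬R with ¬C, ¬R on disjoint variables
      independent : count n (λ x → not (sem S F x)) * N
                  ≡ count n (λ x → not (evalTerm C x)) * count n (λ x → not (sem S R x))
      independent =
        trans (cong (_* N) (count-cong n (λ x → trans (cong not (split x)) (de-morgan (evalTerm C x) _))))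
        (count-∧-independent n _ _ (atLeast k') (below k') (depends-not (term-depends C after-L))
          (depends-not (sem-depends S R)) (atLeast-below-disjoint k'))
        where
        de-morgan : ∀ u v → not (u ∨ v) ≡ not u ∧ not v
        de-morgan true  v = refl
        de-morgan false v = refl

    -- What remains below a maximal parity of variables: a constant, or a
    -- function fixed to some value whenever a literal on a variable below k' holds.
    data ParityTail (k' : ℕ) (f : BoolFn n) : Set where
      constant : ∀ b → (∀ x → f x ≡ b) → ParityTail k' f
      decided  : ∀ (j : Fin n) pol out → below k' j ≡ true → S j ≡ true →
                 (∀ x → evalLit (j , pol) x ≡ true → f x ≡ out) → ParityTail k' f

    record ParitySpine {k} (F : Fm S k) : Set where
      constructor paritySpine
      field
        k'         : ℕ
        literals   : List (Literal n)
        rest       : Fm S k'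
        k'≤k       : k' ≤ k
        lits-below : LitsIn (below k) literals
        lits-after : LitsIn (atLeast k') literals
        lits-S     : LitsIn S literals
        split      : ∀ x → sem S F x ≡ evalTerm (parity literals) x xor sem S rest x
        tail       : ParityTail k' (sem S rest)

    spine-xor : ∀ {k k'} (j : Fin n) (j<k : toℕ j < k) (k'≤j : k' ≤ toℕ j) (s : S j ≡ true)
      (F : Fm S k') → ParitySpine F → ParitySpine (xorVar j j<k k'≤j s F)
    spine-xor j j<k k'≤j s F (paritySpine k'' P Y k''≤k' below-P after-P S-P split tail) =
      paritySpine k'' ((j , true) ∷ P) Y (≤-trans k''≤k' (≤-trans k'≤j (<⇒≤ j<k)))
        (below-in j j<k ∷ litsIn-mono (below-mono (≤-trans k'≤j (<⇒≤ j<k))) below-P)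
        (atLeast-in j (≤-trans k''≤k' k'≤j) ∷ after-P) (s ∷ S-P)
        (λ x → trans (cong (x j xor_) (split x)) (sym (xor-assoc (x j) _ _))) tail

    paritySpineOf : ∀ {k} (F : Fm S k) → ParitySpine F
    paritySpineOf (xorVar j j<k k'≤j s F) = spine-xor j j<k k'≤j s F (paritySpineOf F)
    paritySpineOf {k} F@(const b) = paritySpine k [] F ≤-refl [] [] [] (λ x → refl) (constant b (λ x → refl))
    paritySpineOf {k} F@(ifLit j j<k _ s pol out _) = paritySpine k [] F ≤-refl [] [] [] (λ x → refl)
      (decided j pol out (below-in j j<k) s (λ x ℓ → subst (λ b → (if b then out else _) ≡ out) (sym ℓ) refl))

    -- x_j ⊕ F, of mean 1/2, is approximated exactly if F is a parity up to a
    -- constant, and otherwise by ℓ ∧ (x_j ⊕ P ⊕ out) of mean 1/4, where ℓ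
    -- is a literal forcing the tail of F to the value out.
    approx-xor : ∀ {k k'} (j : Fin n) (j<k : toℕ j < k) (k'≤j : k' ≤ toℕ j) (s : S j ≡ true)
      (F : Fm S k') → ParitySpine F → Approx (xorVar j j<k k'≤j s F)
    approx-xor {k} {k'} j j<k k'≤j s F (paritySpine k'' P Y k''≤k' below-P after-P S-P split tail) = by-tail tail
      where
      X = xorVar j j<k k'≤j s F
      par = evalTerm (parity P)
      P⁺ : Bool → Term n
      P⁺ b = xorTerm j b P
      P⁺-eval : ∀ b x → evalTerm (P⁺ b) x ≡ x j xor (par x xor b)
      P⁺-eval b = xorTerm-eval j b P
      P⁺-below : ∀ {b} → LitsIn (below k) (lits (P⁺ b))
      P⁺-below = below-in j j<k ∷ litsIn-mono (below-mono (≤-trans k'≤j (<⇒≤ j<k))) below-P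
      P⁺-after : ∀ {b} → LitsIn (atLeast k'') (lits (P⁺ b))
      P⁺-after = atLeast-in j (≤-trans k''≤k' k'≤j) ∷ after-P
      by-tail : ParityTail k'' (sem S Y) → Approx X
      by-tail (constant b Y≡) = exact X (P⁺ b ∷ []) ([] ∷ []) (P⁺-below ∷ []) ((s ∷ S-P) ∷ [])
        (λ x → trans (∧-identityʳ _) (trans (P⁺-eval b x)
                 (cong (x j xor_) (sym (trans (split x) (cong (par x xor_) (Y≡ x)))))))
      by-tail (decided j' pol out j'-below S-j' forces) =
        approx ts ((ℓ-disjoint ∷ []) ∷ [] ∷ []) ((below-mono k''≤k j' j'-below ∷ []) ∷ P⁺-below ∷ [])
          ((S-j' ∷ []) ∷ (s ∷ S-P) ∷ []) sound (cubeBound-quarter X-balanced ts-half P⁺-balanced)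
        where
        ℓ = clause ((j' , pol) ∷ [])
        ts = ℓ ∷ P⁺ out ∷ []
        k''≤k = ≤-trans k''≤k' (≤-trans k'≤j (<⇒≤ j<k))
        ℓ-disjoint = disjoint-terms (below-atLeast-disjoint k'') ℓ (P⁺ out) (j'-below ∷ []) P⁺-after
        unfold : ∀ x → evalTerms ts x ≡ evalLit (j' , pol) x ∧ evalTerm (P⁺ out) x
        unfold x = cong₂ _∧_ (∨-identityʳ (evalLit (j' , pol) x)) (∧-identityʳ (evalTerm (P⁺ out) x))
        sound : evalTerms ts ≤fn sem S X
        sound x h = trans (cong (x j xor_) (trans (split x) (cong (par x xor_) (forces x ℓ-holds))))
                          (trans (sym (P⁺-eval out x)) (∧-conicalʳ _ _ h′))
          where
          h′ = trans (sym (unfold x)) h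
          ℓ-holds = ∧-conicalˡ _ _ h′
        X-balanced : count n (sem S X) * 2 ≡ N
        X-balanced = count-xor-fresh n j (sem S F) (below k') (sem-depends S F) (below-false j k'≤j)
        ts-half : count n (evalTerms ts) * 2 ≡ count n (evalTerm (P⁺ out))
        ts-half = trans (cong (_* 2) (count-cong n unfold))
          (count-literal-∧ n j' pol _ (atLeast k'') (term-depends (P⁺ out) P⁺-after) (cong not j'-below))
        P⁺-balanced : count n (evalTerm (P⁺ out)) * 2 ≡ N
        P⁺-balanced = trans (cong (_* 2) (count-cong n (P⁺-eval out)))
          (count-xor-fresh n j (λ x → par x xor out) (below k')
            (λ x y eq → cong (_xor out) (term-depends (parity P) below-P x y eq)) (below-false j k'≤j))

    clause-often-true : ∀ (j : Fin n) pol L →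
      count n (λ x → not (evalTerm (clause ((j , pol) ∷ L)) x)) * 2 ≤ N
    clause-often-true j pol L = subst (count n ¬C * 2 ≤_) (count-literal n j (not pol))
      (*-monoˡ-≤ 2 (count-mono n ¬C _ (λ x h → trans (literal-not j pol x) (not-∨ˡ (evalLit (j , pol) x) _ h))))
      where
      ¬C = λ x → not (evalTerm (clause ((j , pol) ∷ L)) x)
      not-∨ˡ : ∀ u v → not (u ∨ v) ≡ true → not u ≡ true
      not-∨ˡ false v _ = refl

    approximate : ∀ {k} (F : Fm S k) → Approx F
    approximate F@(const true)  = exact F [] [] [] [] (λ x → refl)
    approximate F@(const false) = exact F (clause [] ∷ []) ([] ∷ []) ([] ∷ []) ([] ∷ []) (λ x → refl)
    approximate (ifLit j j<k k'≤j s pol false F) = approx-andNot j j<k k'≤j s pol F (approximate F)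
    approximate (ifLit j j<k k'≤j s pol true F) =
      approx-clause _ (spine-or j j<k k'≤j s pol F σ) (clause-often-true j pol (ClauseSpine.literals σ))
      where σ = clauseSpineOf F
    approximate (xorVar j j<k k'≤j s F) = approx-xor j j<k k'≤j s F (paritySpineOf F)

module Blocks where

  open import Defs
  open Counting
  open Terms
  open Formulas using (sem)
  open Compilation using (compileROBP)
  open Approximation using (approx; approximate)
  open CubeBounds
  open import Data.Bool using (true; false; not; _∧_)
  open import Data.Bool.Properties using (∧-conicalˡ; ∧-conicalʳ)
  open import Data.Nat using (zero; suc; _*_; _^_)
  open import Data.Nat.Properties using (m^n≢0)
  open import Data.Fin using (Fin; zero; suc)
  open import Data.Fin.Properties using (suc-injective)
  open import Data.List using (List; []; _++_)
  open import Data.List.Relation.Unary.All using ([])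
  import Data.List.Relation.Unary.All.Properties as All
  open import Data.List.Relation.Unary.AllPairs using (AllPairs; [])
  import Data.List.Relation.Unary.AllPairs.Properties as AllPairs
  open import Data.Product using (_,_)
  open import Data.Empty using (⊥-elim)
  open import Relation.Binary.PropositionalEquality

  record Approximant {n} (W : VarSet n) (f : BoolFn n) : Set where
    constructor approximant
    field
      terms    : List (Term n)
      disjoint : AllPairs DisjointTerms terms
      within   : TermsIn W terms
      sound    : evalTerms terms ≤fn f
      bound    : CubeBound (2 ^ n) (count n f) (count n (evalTerms terms))

  block-approximant : ∀ {n} (f : BoolFn n) (S : VarSet n) →
    ComputableByWidth2ROBP f → DependsOnlyOn f S → Approximant S f
  block-approximant {n} f S f-robp f-dep with compileROBP f S f-robp f-dep
  ... | F , F≡f with approximate S F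
  ...   | approx ts dj _ inS sound bound =
    approximant ts dj inS (λ x h → trans (sym (F≡f x)) (sound x h))
      (subst (λ c → CubeBound (2 ^ n) c (count n (evalTerms ts))) (count-cong n F≡f) bound)

  bigAnd-depends : ∀ {n} m (fs : Fin m → BoolFn n) V →
    (∀ i → DependsOnlyOn (fs i) V) → DependsOnlyOn (bigAnd fs) V
  bigAnd-depends zero    fs V d x y eq = refl
  bigAnd-depends (suc m) fs V d x y eq =
    cong₂ _∧_ (d zero x y eq) (bigAnd-depends m (λ i → fs (suc i)) V (λ i → d (suc i)) x y eq)

  _∖_ : ∀ {n} → VarSet n → VarSet n → VarSet n
  (W ∖ V) j = W j ∧ not (V j)

  later-blocks : ∀ {n m} (S : Fin (suc m) → VarSet n) (W : VarSet n) → (∀ i j → S i j ≡ true → W j ≡ true) →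
    (∀ i i' → i ≢ i' → DisjointSets (S i) (S i')) → ∀ i j → S (suc i) j ≡ true → (W ∖ S zero) j ≡ true
  later-blocks S W S⊆W disj i j s with S zero j in s₀
  ... | true  = ⊥-elim (disj zero (suc i) (λ ()) j s₀ s)
  ... | false = cong (_∧ true) (S⊆W (suc i) j s)

  conjunction : ∀ {n} m (fs : Fin m → BoolFn n) (S : Fin m → VarSet n) (W : VarSet n) →
    (∀ i j → S i j ≡ true → W j ≡ true) → (∀ i i' → i ≢ i' → DisjointSets (S i) (S i')) →
    (∀ i → DependsOnlyOn (fs i) (S i)) → (∀ i → Approximant (S i) (fs i)) → Approximant W (bigAnd fs)
  conjunction {n} zero fs S W _ _ _ _ = approximant [] [] [] (λ x _ → refl) (cubeBound-refl (count-≤ n _))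
  conjunction {n} (suc m) fs S W S⊆W disj deps approximants
    with approximants zero
       | conjunction m (λ i → fs (suc i)) (λ i → S (suc i)) (W ∖ S zero) (later-blocks S W S⊆W disj)
           (λ i i' i≢i' → disj (suc i) (suc i') (λ eq → i≢i' (suc-injective eq))) (λ i → deps (suc i))
           (λ i → approximants (suc i))
  ... | approximant ts₀ dj₀ in₀ sound₀ bound₀ | approximant tsᵣ djᵣ inᵣ soundᵣ boundᵣ =
    approximant (ts₀ ++ tsᵣ)
      (AllPairs.++⁺ dj₀ djᵣ (disjoint-term-lists S₀-disjoint in₀ (termsIn-mono W′⊆¬S₀ inᵣ)))
      (All.++⁺ (termsIn-mono (S⊆W zero) in₀) (termsIn-mono W′⊆W inᵣ)) sound
      (cubeBound-∧ {{m^n≢0 2 n}} f-independent g-independent bound₀ boundᵣ)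
    where
    ¬S₀ : VarSet n
    ¬S₀ j = not (S zero j)
    W′⊆W : ∀ j → (W ∖ S zero) j ≡ true → W j ≡ true
    W′⊆W j = ∧-conicalˡ (W j) _
    W′⊆¬S₀ : ∀ j → (W ∖ S zero) j ≡ true → ¬S₀ j ≡ true
    W′⊆¬S₀ j = ∧-conicalʳ (W j) _
    S₀-disjoint : DisjointSets (S zero) ¬S₀
    S₀-disjoint j a b = complement-disjoint (S zero) j b a
    rest = bigAnd (λ i → fs (suc i))
    sound : evalTerms (ts₀ ++ tsᵣ) ≤fn bigAnd fs
    sound x h rewrite evalTerms-++ ts₀ tsᵣ x =
      cong₂ _∧_ (sound₀ x (∧-conicalˡ _ _ h)) (soundᵣ x (∧-conicalʳ _ _ h))
    f-independent : count n (bigAnd fs) * 2 ^ n ≡ count n (fs zero) * count n rest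
    f-independent = count-∧-independent n (fs zero) rest (S zero) ¬S₀ (deps zero)
      (bigAnd-depends m _ ¬S₀ λ i →
        depends-mono (λ j s → W′⊆¬S₀ j (later-blocks S W S⊆W disj i j s)) (deps (suc i)))
      S₀-disjoint
    g-independent : count n (evalTerms (ts₀ ++ tsᵣ)) * 2 ^ n ≡ count n (evalTerms ts₀) * count n (evalTerms tsᵣ)
    g-independent = trans (cong (_* 2 ^ n) (count-cong n (evalTerms-++ ts₀ tsᵣ)))
      (count-∧-independent n _ _ (S zero) ¬S₀ (terms-depend ts₀ in₀)
        (terms-depend tsᵣ (termsIn-mono W′⊆¬S₀ inᵣ)) S₀-disjoint)

module Rationals where

  open import Defs
  open CubeBounds using (CubeBound; cubeBound)
  open Blocks using (Approximant; approximant)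
  open import Data.Nat using (suc; _*_; _^_; NonZero) renaming (_≤_ to _≤ℕ_)
  open import Data.Nat.Properties using (*-monoˡ-≤; m^n≢0)
  open import Data.Product using (Σ; _×_; _,_)
  open import Data.Integer using (+_) renaming (_*_ to _*ℤ_; _≤_ to _≤ℤ_)
  open import Data.Integer.Properties using (pos-*)
  import Data.Integer as ℤ
  open import Data.Rational using (_/_; 1ℚ; _≤_; toℚᵘ) renaming (_*_ to _*ℚ_)
  open import Data.Rational.Properties using (toℚᵘ-cancel-≤; toℚᵘ-homo-*; toℚᵘ-fromℚᵘ)
  open import Data.Rational.Unnormalised using (mkℚᵘ; *≤*)
    renaming (_*_ to _*ᵘ_; _≤_ to _≤ᵘ_; _≃_ to _≃ᵘ_)
  open import Data.Rational.Unnormalised.Properties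
    using (≃-refl; ≃-sym; ≃-trans; *-cong; ≤-respˡ-≃; ≤-respʳ-≃)
  open import Relation.Binary.PropositionalEquality
  open import Data.Nat.Tactic.RingSolver using (solve-∀)

  cubeBound⇒ℚ : ∀ N .{{_ : NonZero N}} a b → CubeBound N a b → ((+ a) / N) ^ℚ 3 ≤ (+ b) / N
  cubeBound⇒ℚ N@(suc d) a b (cubeBound a³≤bN²) =
    toℚᵘ-cancel-≤ (≤-respˡ-≃ (≃-sym cube-unnormalised) (≤-respʳ-≃ (≃-sym (toℚᵘ-fromℚᵘ Q)) P³≤Q))
    where
    q = (+ a) / N
    P = mkℚᵘ (+ a) d
    Q = mkℚᵘ (+ b) d
    q≃P : toℚᵘ q ≃ᵘ P
    q≃P = toℚᵘ-fromℚᵘ P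
    cube-unnormalised : toℚᵘ (q *ℚ (q *ℚ (q *ℚ 1ℚ))) ≃ᵘ P *ᵘ (P *ᵘ (P *ᵘ toℚᵘ 1ℚ))
    cube-unnormalised = ≃-trans (toℚᵘ-homo-* q _) (*-cong q≃P (≃-trans (toℚᵘ-homo-* q _)
      (*-cong q≃P (≃-trans (toℚᵘ-homo-* q 1ℚ) (*-cong q≃P ≃-refl)))))
    in-ℕ : a * (a * (a * 1)) * N ≤ℕ b * (N * (N * (N * 1)))
    in-ℕ = subst₂ _≤ℕ_ (regroupˡ a N) (regroupʳ b N) (*-monoˡ-≤ N a³≤bN²)
      where
      regroupˡ : ∀ a N → a * (a * a) * N ≡ a * (a * (a * 1)) * N
      regroupˡ = solve-∀
      regroupʳ : ∀ b N → b * (N * N) * N ≡ b * (N * (N * (N * 1)))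
      regroupʳ = solve-∀
    numerator : (+ a *ℤ (+ a *ℤ (+ a *ℤ + 1))) *ℤ (+ N) ≡ + (a * (a * (a * 1)) * N)
    numerator = begin
      (+ a *ℤ (+ a *ℤ (+ a *ℤ + 1))) *ℤ + N ≡⟨ cong (λ z → (+ a *ℤ (+ a *ℤ z)) *ℤ + N) (sym (pos-* a 1)) ⟩
      (+ a *ℤ (+ a *ℤ + (a * 1))) *ℤ + N    ≡⟨ cong (λ z → (+ a *ℤ z) *ℤ + N) (sym (pos-* a (a * 1))) ⟩
      (+ a *ℤ + (a * (a * 1))) *ℤ + N       ≡⟨ cong (_*ℤ + N) (sym (pos-* a (a * (a * 1)))) ⟩
      + (a * (a * (a * 1))) *ℤ + N          ≡⟨ sym (pos-* (a * (a * (a * 1))) N) ⟩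
      + (a * (a * (a * 1)) * N)             ∎
      where open ≡-Reasoning
    P³≤Q : P *ᵘ (P *ᵘ (P *ᵘ toℚᵘ 1ℚ)) ≤ᵘ Q
    P³≤Q = *≤* (subst₂ _≤ℤ_ (sym numerator) (pos-* b _) (ℤ.+≤+ in-ℕ))

  approximant⇒CNF⊕ : ∀ {n} {W : VarSet n} {f : BoolFn n} → Approximant W f →
    Σ (CNF⊕ n) λ g → (evalCNF⊕ g ≤fn f) × (𝔼 f ^ℚ 3 ≤ 𝔼 (evalCNF⊕ g))
  approximant⇒CNF⊕ {n} (approximant ts disjoint _ sound bound) =
    record { terms = ts ; disjoint = disjoint } , sound , cubeBound⇒ℚ (2 ^ n) {{m^n≢0 2 n}} _ _ bound


open import Defs
open import Data.Nat using (ℕ)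
open import Data.Fin using (Fin)
open import Data.Product using (Σ; ∃; _×_)
open import Data.Rational using (_≤_)
open import Relation.Binary.PropositionalEquality using (_≢_)

open import Data.Bool using (true)
open import Data.Product using (_,_)
open import Relation.Binary.PropositionalEquality using (refl)
open Blocks using (block-approximant; conjunction)
open Rationals using (approximant⇒CNF⊕)

theorem6p12 : ∃ λ (c : ℕ) →
    ∀ (n m : ℕ) (fs : Fin m → BoolFn n) (S : Fin m → VarSet n) →
      (∀ i → ComputableByWidth2ROBP (fs i)) →
      (∀ i → DependsOnlyOn (fs i) (S i)) →
      (∀ i i' → i ≢ i' → DisjointSets (S i) (S i')) →
      Σ (CNF⊕ n) λ g →
        (evalCNF⊕ g ≤fn bigAnd fs) × (𝔼 (bigAnd fs) ^ℚ c ≤ 𝔼 (evalCNF⊕ g))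
theorem6p12 = 3 , λ n m fs S computable depends disjoint →
  approximant⇒CNF⊕ (conjunction m fs S (λ _ → true) (λ _ _ _ → refl) disjoint depends
    (λ i → block-approximant (fs i) (S i) (computable i) (depends i)))
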